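{- Let $k\geq 3$ be an integer and let $M_1=\{e_1,\dots,e_{\lfloor k/2\rfloor}\}$ and $M_2=\{e_{\lfloor k/2\rfloor+1},\dots,e_{k-2}\}$ be two edge-disjoint matchings of $K_k$. For every $1\leq i\leq k-2$, let $H_i=K_k\setminus\{e_1,\dots,e_i\}$ (the graph on the vertex set of $K_k$ with these edges removed). (i) For every $1\leq i\leq k-2$, if $k\neq 5$ or $i\neq 3$, then $g_1(H_i)=(v(H_i)-2)/e(H_i)$. (ii) $g_2(H_i)=(v(H_i)-2)/(e(H_i)-1)$ for every $1\leq i\leq k-2$.
   Context: $\mathcal I_H$ is the set of subgraphs $H'\neq H$ of $H$ that are cliques (complete graphs); $\mathcal I^c_H$ is the set of all other subgraphs of $H$. For $H$ with at least two edges, $g_1(H)=\max\{\frac{v(H)-v(H')}{e(H)-e(H')}: H'\in\mathcal I^c_H, (2\leq e(H')<e(H) \text{ or } (e(H')=0, v(H')=2))\}$ and $g_2(H)=\min\{\frac{v(H')-2}{e(H')-1}: H'\subseteq H, e(H')\geq 2, (H'\in\mathcal I_H \text{ or } H'=H)\}$; $v(G),e(G)$ are the numbers of vertices and edges. -}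

module Defs where

open import Data.Bool using (Bool; true; false; _∧_; _∨_; not; if_then_else_)
open import Data.Nat using (ℕ; zero; suc; _∸_; _≤_; _<_; _<ᵇ_)
open import Data.Fin using (Fin; toℕ; _≟_)
open import Data.List using (List; []; _∷_; concatMap; map; allFin)
open import Data.Bool.ListAction using (any)
open import Data.Product using (_×_; _,_; ∃; proj₁; proj₂)
open import Data.Sum using (_⊎_)
open import Data.Integer using (+_)
open import Data.Rational using (ℚ; _/_; 0ℚ)
open import Relation.Nullary using (¬_)
open import Relation.Nullary.Decidable using (⌊_⌋)
open import Relation.Binary.PropositionalEquality using (_≡_; _≢_)

-- Finite graphs whose vertices are drawn from Fin n.
-- V u   : is u a vertex of the graph
-- E u w : is {u,w} an edge (only meaningful for well-formed graphs)

record Graph (n : ℕ) : Set where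
  constructor mkGraph
  field
    V : Fin n → Bool
    E : Fin n → Fin n → Bool
open Graph public

record WellFormed {n : ℕ} (G : Graph n) : Set where
  field
    E-sym : ∀ u w → E G u w ≡ E G w u
    E-irr : ∀ u → E G u u ≡ false
    E-V   : ∀ u w → E G u w ≡ true → V G u ≡ true

countTrue : List Bool → ℕ
countTrue [] = 0
countTrue (true ∷ bs) = suc (countTrue bs)
countTrue (false ∷ bs) = countTrue bs

pairs : (n : ℕ) → List (Fin n × Fin n)
pairs n = concatMap (λ u → map (λ w → (u , w)) (allFin n)) (allFin n)

v : {n : ℕ} → Graph n → ℕ
v {n} G = countTrue (map (V G) (allFin n))

e : {n : ℕ} → Graph n → ℕ
e {n} G = countTrue (map (λ p → (toℕ (proj₁ p) <ᵇ toℕ (proj₂ p)) ∧ E G (proj₁ p) (proj₂ p)) (pairs n))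

record _⊆G_ {n : ℕ} (H' H : Graph n) : Set where
  field
    wf  : WellFormed H'
    V⊆ : ∀ u → V H' u ≡ true → V H u ≡ true
    E⊆ : ∀ u w → E H' u w ≡ true → E H u w ≡ true

SameGraph : {n : ℕ} → Graph n → Graph n → Set
SameGraph G G' = (∀ u → V G u ≡ V G' u) × (∀ u w → E G u w ≡ E G' u w)

IsClique : {n : ℕ} → Graph n → Set
IsClique G = ∀ u w → u ≢ w → V G u ≡ true → V G w ≡ true → E G u w ≡ true

InI : {n : ℕ} → Graph n → Graph n → Set
InI H H' = H' ⊆G H × ¬ SameGraph H' H × IsClique H'

InIc : {n : ℕ} → Graph n → Graph n → Set
InIc H H' = H' ⊆G H × ¬ InI H H'

-- a / b as a rational; the junk value for b = 0 is never used in the statement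
frac : ℕ → ℕ → ℚ
frac a zero = 0ℚ
frac a (suc b) = (+ a) / suc b

-- g₁ and g₂, as "q is the maximum / minimum of the defining set"

G1Cand : {n : ℕ} → Graph n → Graph n → Set
G1Cand H H' = InIc H H' × ((2 ≤ e H' × e H' < e H) ⊎ (e H' ≡ 0 × v H' ≡ 2))

g1ratio : {n : ℕ} → Graph n → Graph n → ℚ
g1ratio H H' = frac (v H ∸ v H') (e H ∸ e H')

IsG1 : {n : ℕ} → Graph n → ℚ → Set
IsG1 H q = (∃ λ H' → G1Cand H H' × g1ratio H H' ≡ q)
         × (∀ H' → G1Cand H H' → g1ratio H H' Data.Rational.≤ q)

G2Cand : {n : ℕ} → Graph n → Graph n → Set
G2Cand H H' = H' ⊆G H × 2 ≤ e H' × (InI H H' ⊎ SameGraph H' H)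

g2ratio : {n : ℕ} → Graph n → ℚ
g2ratio H' = frac (v H' ∸ 2) (e H' ∸ 1)

IsG2 : {n : ℕ} → Graph n → ℚ → Set
IsG2 H q = (∃ λ H' → G2Cand H H' × g2ratio H' ≡ q)
         × (∀ H' → G2Cand H H' → q Data.Rational.≤ g2ratio H')

-- Edges of K_k given as pairs of endpoints; the sequence e₁,…,e_{k-2}
-- is a function Fin (k ∸ 2) → Fin k × Fin k (index j stands for e_{j+1}).

Edge : ℕ → Set
Edge k = Fin k × Fin k

IsEdge : {k : ℕ} → Edge k → Set
IsEdge (a , b) = a ≢ b

SameEdge : {k : ℕ} → Edge k → Edge k → Set
SameEdge (a , b) (c , d) = (a ≡ c × b ≡ d) ⊎ (a ≡ d × b ≡ c)

VertexDisjoint : {k : ℕ} → Edge k → Edge k → Set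
VertexDisjoint (a , b) (c , d) = a ≢ c × a ≢ d × b ≢ c × b ≢ d

sameEdgeᵇ : {k : ℕ} → Edge k → Fin k → Fin k → Bool
sameEdgeᵇ (a , b) u w = (⌊ a ≟ u ⌋ ∧ ⌊ b ≟ w ⌋) ∨ (⌊ a ≟ w ⌋ ∧ ⌊ b ≟ u ⌋)

-- H_i = K_k ∖ {e₁,…,e_i}  (removes the edges with index j < i, 0-based)
Hgraph : (k : ℕ) → (Fin (k ∸ 2) → Edge k) → ℕ → Graph k
Hgraph k es i = mkGraph (λ _ → true)
  (λ u w → not ⌊ u ≟ w ⌋ ∧ not (any (λ j → (toℕ j <ᵇ i) ∧ sameEdgeᵇ (es j) u w) (allFin (k ∸ 2))))

module Submission where

open import Defs
open import Data.Nat using (ℕ; _≤_; _<_; _∸_)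
open import Data.Nat.DivMod using (_/_)
open import Data.Fin using (Fin; toℕ)
open import Data.Product using (_×_)
open import Data.Sum using (_⊎_)
open import Relation.Nullary using (¬_)
open import Relation.Binary.PropositionalEquality using (_≡_; _≢_)

open import Data.Bool using (Bool; true; false; _∧_; _∨_; not)
open import Data.Bool.ListAction using (any; or)
open import Data.Bool.Properties using (T-≡; ∧-comm; ∧-zeroʳ; ∨-comm; ∨-zeroʳ; not-involutive)
open import Data.Empty using (⊥; ⊥-elim)
open import Data.Fin using (zero; suc; fromℕ<; _≟_)
import Data.Fin.Properties as Fin
import Data.Integer as ℤ
import Data.Integer.Properties as ℤ
open import Data.List using (List; []; _∷_; _++_; map; concat; tabulate; allFin)
open import Data.List.Membership.Propositional using (lose)
open import Data.List.Membership.Propositional.Properties using (∈-allFin)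
open import Data.List.Properties using (map-tabulate; map-concatMap; map-cong)
open import Data.List.Relation.Unary.Any.Properties using (any⁺)
open import Data.Nat hiding (_≟_; _/_)
import Data.Nat as ℕ
open import Data.Nat.Combinatorics using (_C_; nC1≡n; nCk+nC[k+1]≡[n+1]C[k+1])
open import Data.Nat.DivMod using (/-monoˡ-≤)
open import Data.Nat.Properties hiding (_≟_)
open import Data.Nat.Tactic.RingSolver using (solve-∀)
open import Data.Product using (∃; _,_; proj₁; proj₂)
open import Data.Sum using (inj₁; inj₂)
import Data.Rational as ℚ
import Data.Rational.Properties as ℚ
import Data.Rational.Unnormalised as ℚᵘ
import Data.Rational.Unnormalised.Properties as ℚᵘ
open import Function using (_∘_; id)
open import Function.Bundles using (Equivalence)
open import Relation.Binary using (tri<; tri≈; tri>)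
open import Relation.Binary.PropositionalEquality
open import Relation.Nullary using (Dec; contradiction; yes; no)
open import Relation.Nullary.Decidable using (⌊_⌋; dec-true; isYes≗does)

open import Algebra.Properties.CommutativeSemigroup *-commutativeSemigroup using (x∙yz≈y∙xz)
open import Algebra.Properties.Semiring.Sum +-*-semiring
  using (sum; sum-cong-≗; sum-replicate-zero; ∑-distrib-+; ∑-comm; *-distribˡ-sum)

-- Let R ≤ i be the number of removed edges and, for a subgraph H′ of H_i, let t = v(H′) and m = k − t.
-- Every vertex lies on at most one edge of each matching, so at most 2m removed edges meet a missing
-- vertex; the others are non-edges of H′, whence e(H′) + R ≤ C(t,2) + 2m. For g₁ and a non-clique H′
-- (e(H′) < C(t,2)) this reduces (k − t)/(e(H_i) − e(H′)) ≤ (k − 2)/e(H_i) to an inequality between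
-- polynomials in t, m, e(H′) and R. Its case m = 1, t = 4 needs R ≤ 2, which is why k = 5, i = 3 is
-- excluded; two isolated vertices attain the maximum. For g₂, a proper clique H′ misses an endpoint of
-- e₁, and also one of the disjoint edge e₂ ∈ M₁ when i ≥ 2; thus 2R ≤ m(k − 2), which is exactly what
-- (k − 2)/(e(H_i) − 1) ≤ (t − 2)/(C(t,2) − 1) needs, and H_i itself attains the minimum.

[1+n]C2≡n+nC2 : ∀ n → suc n C 2 ≡ n + n C 2
[1+n]C2≡n+nC2 n = trans (sym (nCk+nC[k+1]≡[n+1]C[k+1] n 1)) (cong (_+ n C 2) (nC1≡n n))

2*[1+n]C2≡[1+n]*n : ∀ n → 2 * (suc n C 2) ≡ suc n * n
2*[1+n]C2≡[1+n]*n zero    = refl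
2*[1+n]C2≡[1+n]*n (suc n) = begin
  2 * (suc (suc n) C 2)        ≡⟨ cong (2 *_) ([1+n]C2≡n+nC2 (suc n)) ⟩
  2 * (suc n + suc n C 2)      ≡⟨ *-distribˡ-+ 2 (suc n) _ ⟩
  2 * suc n + 2 * (suc n C 2)  ≡⟨ cong (2 * suc n +_) (2*[1+n]C2≡[1+n]*n n) ⟩
  2 * suc n + suc n * n        ≡⟨ expand n ⟩
  suc (suc n) * suc n          ∎
  where
  open ≡-Reasoning
  expand : ∀ n → 2 * suc n + suc n * n ≡ suc (suc n) * suc n
  expand = solve-∀

2*[[2+s]C2∸1]≡s*[s+3] : ∀ s → 2 * ((2 + s) C 2 ∸ 1) ≡ s * (s + 3)
2*[[2+s]C2∸1]≡s*[s+3] s = begin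
  2 * ((2 + s) C 2 ∸ 1)     ≡⟨ cong (λ x → 2 * (x ∸ 1)) ([1+n]C2≡n+nC2 (suc s)) ⟩
  2 * (s + suc s C 2)       ≡⟨ *-distribˡ-+ 2 s _ ⟩
  2 * s + 2 * (suc s C 2)   ≡⟨ cong (2 * s +_) (2*[1+n]C2≡[1+n]*n s) ⟩
  2 * s + suc s * s         ≡⟨ expand s ⟩
  s * (s + 3)               ∎
  where
  open ≡-Reasoning
  expand : ∀ s → 2 * s + suc s * s ≡ s * (s + 3)
  expand = solve-∀

0<nC2⇒2≤n : ∀ n → 0 < n C 2 → 2 ≤ n
0<nC2⇒2≤n (suc (suc _)) _ = s≤s (s≤s z≤n)

2≤nC2⇒3≤n : ∀ n → 2 ≤ n C 2 → 3 ≤ n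
2≤nC2⇒3≤n 2 (s≤s ())
2≤nC2⇒3≤n (suc (suc (suc _))) _ = s≤s (s≤s (s≤s z≤n))

3≤n⇒n≤nC2 : ∀ n → 3 ≤ n → n ≤ n C 2
3≤n⇒n≤nC2 1 (s≤s ())
3≤n⇒n≤nC2 2 (s≤s (s≤s ()))
3≤n⇒n≤nC2 (suc (suc (suc u))) _ = begin
  3 + u                              ≡⟨ +-comm 1 (2 + u) ⟩
  (2 + u) + 1                        ≤⟨ +-monoʳ-≤ (2 + u) (m≤m+n 1 _) ⟩
  (2 + u) + (1 + (u + suc u C 2))    ≡⟨ cong ((2 + u) +_) ([1+n]C2≡n+nC2 (suc u)) ⟨
  (2 + u) + (2 + u) C 2              ≡⟨ [1+n]C2≡n+nC2 (2 + u) ⟨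
  (3 + u) C 2                        ∎
  where open ≤-Reasoning

g2-bound : ∀ t m E R → 2 ≤ t → suc E + R ≡ (t + m) C 2 → 2 * R ≤ m * (t + m ∸ 2)
         → (t + m ∸ 2) * (t C 2 ∸ 1) ≤ (t ∸ 2) * E
g2-bound 1 _ _ _ (s≤s ()) _ _
g2-bound (suc (suc s)) m E R _ total 2R≤ = *-cancelˡ-≤ 2 (begin
  2 * (K * ((2 + s) C 2 ∸ 1))   ≡⟨ x∙yz≈y∙xz 2 K _ ⟩
  K * (2 * ((2 + s) C 2 ∸ 1))   ≡⟨ cong (K *_) (2*[[2+s]C2∸1]≡s*[s+3] s) ⟩
  K * (s * (s + 3))             ≡⟨ x∙yz≈y∙xz K s (s + 3) ⟩
  s * (K * (s + 3))             ≤⟨ *-monoʳ-≤ s K*[s+3]≤2E ⟩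
  s * (2 * E)                   ≡⟨ x∙yz≈y∙xz s 2 E ⟩
  2 * (s * E)                   ∎)
  where
  open ≤-Reasoning
  K = s + m
  double : ∀ E R → 2 * (suc E + R) ≡ 2 * E + (2 + 2 * R)
  double = solve-∀
  expand : ∀ s m → (s + m) * (s + 3) + (2 + m * (s + m)) ≡ suc (suc s + m) * (suc s + m)
  expand = solve-∀
  K*[s+3]≤2E : K * (s + 3) ≤ 2 * E
  K*[s+3]≤2E = +-cancelʳ-≤ (2 + 2 * R) _ _ (begin
    K * (s + 3) + (2 + 2 * R)       ≤⟨ +-monoʳ-≤ (K * (s + 3)) (+-monoʳ-≤ 2 2R≤) ⟩
    K * (s + 3) + (2 + m * K)       ≡⟨ expand s m ⟩
    suc (suc s + m) * (suc s + m)   ≡⟨ 2*[1+n]C2≡[1+n]*n (suc s + m) ⟨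
    2 * ((2 + s + m) C 2)           ≡⟨ cong (2 *_) total ⟨
    2 * (suc E + R)                 ≡⟨ double E R ⟩
    2 * E + (2 + 2 * R)             ∎)

g1-bound-≥2 : ∀ s m e′ d R → 2 ≤ m → 2 * (e′ + d + R) ≡ (2 + s + m) * (1 + s + m)
            → R ≤ s + m → 2 * e′ ≤ s * (s + 3) → m * e′ ≤ s * d
g1-bound-≥2 s m e′ d R m≥2 total R≤ 2e′≤ =
  *-cancelˡ-≤ 2 (+-cancelʳ-≤ (2 * (s * e′) + 2 * (s * R)) _ _ (begin
    2 * (m * e′) + (2 * (s * e′) + 2 * (s * R))  ≡⟨ regroup s m e′ R ⟩
    K * (2 * e′) + s * (2 * R)                    ≤⟨ +-mono-≤ (*-monoʳ-≤ K 2e′≤′) (*-monoʳ-≤ s (*-monoʳ-≤ 2 R≤)) ⟩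
    K * (s * (s + (m + 1))) + s * (2 * K)         ≤⟨ m≤m+n _ (2 * s) ⟩
    K * (s * (s + (m + 1))) + s * (2 * K) + 2 * s ≡⟨ expand s m ⟩
    s * ((2 + s + m) * (1 + s + m))               ≡⟨ cong (s *_) total ⟨
    s * (2 * (e′ + d + R))                        ≡⟨ distribute s e′ d R ⟩
    2 * (s * d) + (2 * (s * e′) + 2 * (s * R))    ∎))
  where
  open ≤-Reasoning
  K = s + m
  2e′≤′ : 2 * e′ ≤ s * (s + (m + 1))
  2e′≤′ = ≤-trans 2e′≤ (*-monoʳ-≤ s (+-monoʳ-≤ s (+-monoˡ-≤ 1 m≥2)))
  regroup : ∀ s m e′ R → 2 * (m * e′) + (2 * (s * e′) + 2 * (s * R)) ≡ (s + m) * (2 * e′) + s * (2 * R)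
  regroup = solve-∀
  expand : ∀ s m → (s + m) * (s * (s + (m + 1))) + s * (2 * (s + m)) + 2 * s ≡ s * ((2 + s + m) * (1 + s + m))
  expand = solve-∀
  distribute : ∀ s e′ d R → s * (2 * (e′ + d + R)) ≡ 2 * (s * d) + (2 * (s * e′) + 2 * (s * R))
  distribute = solve-∀

[3+s]C2≤s*d+[d+R] : ∀ s d R → 1 ≤ s → 3 + s ≤ d + R → s ≤ d → R ≤ s + 1 → (s ≡ 2 → R ≤ 2)
                  → (3 + s) C 2 ≤ s * d + (d + R)
[3+s]C2≤s*d+[d+R] 1 d R _ d+R≥4 _ R≤2 _ = +-cancelʳ-≤ R _ _ (begin
  6 + R                ≤⟨ +-monoʳ-≤ 6 R≤2 ⟩
  8                    ≤⟨ *-monoʳ-≤ 2 d+R≥4 ⟩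
  2 * (d + R)          ≡⟨ regroup d R ⟩
  1 * d + (d + R) + R  ∎)
  where
  open ≤-Reasoning
  regroup : ∀ d R → 2 * (d + R) ≡ 1 * d + (d + R) + R
  regroup = solve-∀
-- s = 2 (t = 4, k = 5) is the one case where R ≤ s + 1 does not suffice.
[3+s]C2≤s*d+[d+R] 2 d R _ d+R≥5 _ _ k≡5⇒R≤2 = +-cancelʳ-≤ (2 * R) _ _ (begin
  10 + 2 * R                ≤⟨ +-monoʳ-≤ 10 (*-monoʳ-≤ 2 (k≡5⇒R≤2 refl)) ⟩
  14                        ≤⟨ n≤1+n 14 ⟩
  15                        ≤⟨ *-monoʳ-≤ 3 d+R≥5 ⟩
  3 * (d + R)               ≡⟨ regroup d R ⟩
  2 * d + (d + R) + 2 * R   ∎)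
  where
  open ≤-Reasoning
  regroup : ∀ d R → 3 * (d + R) ≡ 2 * d + (d + R) + 2 * R
  regroup = solve-∀
[3+s]C2≤s*d+[d+R] (suc (suc (suc u))) d R _ d+R≥ d≥s _ _ = begin
  (3 + s) C 2      ≤⟨ *-cancelˡ-≤ 2 doubled ⟩
  s * s + (3 + s)  ≤⟨ +-mono-≤ (*-monoʳ-≤ s d≥s) d+R≥ ⟩
  s * d + (d + R)  ∎
  where
  open ≤-Reasoning
  s = 3 + u
  expand : ∀ u → (3 + (3 + u)) * (2 + (3 + u)) + (3 + u) * u ≡ 2 * ((3 + u) * (3 + u) + (3 + (3 + u)))
  expand = solve-∀
  doubled : 2 * ((3 + s) C 2) ≤ 2 * (s * s + (3 + s))
  doubled = begin
    2 * ((3 + s) C 2)              ≡⟨ 2*[1+n]C2≡[1+n]*n (2 + s) ⟩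
    (3 + s) * (2 + s)              ≤⟨ m≤m+n _ (s * u) ⟩
    (3 + s) * (2 + s) + s * u      ≡⟨ expand u ⟩
    2 * (s * s + (3 + s))          ∎

g1-bound-1 : ∀ s e′ d R → 1 ≤ s → e′ + d + R ≡ (3 + s) C 2 → R ≤ s + 1 → (s ≡ 2 → R ≤ 2)
           → e′ < (2 + s) C 2 → e′ + R ≤ (2 + s) C 2 + 2 → e′ ≤ s * d
g1-bound-1 s e′ d R s≥1 total R≤ k≡5⇒R≤2 e′< e′+R≤ =
  +-cancelʳ-≤ (d + R) e′ (s * d) (begin
    e′ + (d + R)     ≡⟨ +-assoc e′ d R ⟨
    e′ + d + R       ≡⟨ total ⟩
    (3 + s) C 2      ≤⟨ [3+s]C2≤s*d+[d+R] s d R s≥1 d+R≥ d≥s R≤ k≡5⇒R≤2 ⟩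
    s * d + (d + R)  ∎)
  where
  open ≤-Reasoning
  c = (2 + s) C 2
  total′ : e′ + d + R ≡ (2 + s) + c
  total′ = trans total ([1+n]C2≡n+nC2 (2 + s))
  shift : ∀ e′ s → e′ + (3 + s) ≡ (2 + s) + suc e′
  shift = solve-∀
  swap : ∀ e′ d R → e′ + d + R ≡ d + (e′ + R)
  swap = solve-∀
  shift′ : ∀ s c → s + (c + 2) ≡ (2 + s) + c
  shift′ = solve-∀
  d+R≥ : 3 + s ≤ d + R
  d+R≥ = +-cancelˡ-≤ e′ _ _ (begin
    e′ + (3 + s)      ≡⟨ shift e′ s ⟩
    (2 + s) + suc e′  ≤⟨ +-monoʳ-≤ (2 + s) e′< ⟩
    (2 + s) + c       ≡⟨ total′ ⟨
    e′ + d + R        ≡⟨ +-assoc e′ d R ⟩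
    e′ + (d + R)      ∎)
  d≥s : s ≤ d
  d≥s = +-cancelʳ-≤ (c + 2) s d (begin
    s + (c + 2)   ≡⟨ shift′ s c ⟩
    (2 + s) + c   ≡⟨ total′ ⟨
    e′ + d + R    ≡⟨ swap e′ d R ⟩
    d + (e′ + R)  ≤⟨ +-monoʳ-≤ d e′+R≤ ⟩
    d + (c + 2)   ∎)

g1-bound : ∀ t m e′ d R → e′ + d + R ≡ (t + m) C 2 → 2 + R ≤ t + m → (t + m ≡ 5 → R ≤ 2)
         → e′ < t C 2 → e′ + R ≤ t C 2 + 2 * m → m * e′ ≤ (t ∸ 2) * d
g1-bound 0 _ _ _ _ _ _ _ () _
g1-bound 1 _ _ _ _ _ _ _ () _
g1-bound t zero _ _ _ _ _ _ _ _ = z≤n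
g1-bound 2 m zero _ _ _ _ _ _ _ = ≤-reflexive (*-zeroʳ m)
g1-bound 2 (suc m) (suc e′) _ _ _ _ _ (s≤s ()) _
g1-bound (suc (suc (suc s))) 1 e′ d R total R≤ k≡5⇒R≤2 e′< e′+R≤ =
  subst (_≤ suc s * d) (sym (*-identityˡ e′))
    (g1-bound-1 (suc s) e′ d R (s≤s z≤n) (trans total (cong (λ x → (3 + x) C 2) (+-comm s 1)))
       (≤-pred (≤-pred R≤)) (λ s≡2 → k≡5⇒R≤2 (cong (3 +_) (trans (+-comm s 1) s≡2))) e′< e′+R≤)
g1-bound (suc (suc (suc s))) (suc (suc m)) e′ d R total R≤ _ e′< _ =
  g1-bound-≥2 (suc s) (2 + m) e′ d R (s≤s (s≤s z≤n))
    (trans (cong (2 *_) total) (2*[1+n]C2≡[1+n]*n (2 + s + (2 + m)))) (≤-pred (≤-pred R≤)) 2e′≤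
  where
  open ≤-Reasoning
  shift : ∀ e → 2 * e + 2 ≡ 2 * suc e
  shift = solve-∀
  expand : ∀ s → (3 + s) * (2 + s) ≡ suc s * (suc s + 3) + 2
  expand = solve-∀
  2e′≤ : 2 * e′ ≤ suc s * (suc s + 3)
  2e′≤ = +-cancelʳ-≤ 2 _ _ (begin
    2 * e′ + 2                 ≡⟨ shift e′ ⟩
    2 * suc e′                 ≤⟨ *-monoʳ-≤ 2 e′< ⟩
    2 * ((3 + s) C 2)          ≡⟨ 2*[1+n]C2≡[1+n]*n (2 + s) ⟩
    (3 + s) * (2 + s)          ≡⟨ expand s ⟩
    suc s * (suc s + 3) + 2    ∎)

-- frac a (suc b) is definitionally fromℚᵘ (a / suc b), whose order is cross-multiplication.
frac-≤ : ∀ a b c d → 1 ≤ b → 1 ≤ d → a * d ≤ c * b → frac a b ℚ.≤ frac c d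
frac-≤ a (suc b) c (suc d) _ _ ad≤cb = ℚ.toℚᵘ-cancel-≤
  (ℚᵘ.≤-respˡ-≃ (ℚᵘ.≃-sym (ℚ.toℚᵘ-fromℚᵘ (ℚᵘ.mkℚᵘ (ℤ.+ a) b)))
  (ℚᵘ.≤-respʳ-≃ (ℚᵘ.≃-sym (ℚ.toℚᵘ-fromℚᵘ (ℚᵘ.mkℚᵘ (ℤ.+ c) d)))
    (ℚᵘ.*≤* (subst₂ ℤ._≤_ (ℤ.pos-* a (suc d)) (ℤ.pos-* c (suc b)) (ℤ.+≤+ ad≤cb)))))

g1-ratio≤ : ∀ {k t E e′} m d → 2 ≤ t → k ≡ t + m → E ≡ e′ + d → 1 ≤ d → m * e′ ≤ (t ∸ 2) * d
          → frac (k ∸ t) (E ∸ e′) ℚ.≤ frac (k ∸ 2) E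
g1-ratio≤ {t = 1} _ _ (s≤s ()) _ _ _ _
g1-ratio≤ {t = suc (suc s)} {e′ = e′} m d _ refl refl d≥1 m*e′≤
  rewrite m+n∸m≡n s m | m+n∸m≡n e′ d =
  frac-≤ m d (s + m) (e′ + d) d≥1 (≤-trans d≥1 (m≤n+m d e′)) (begin
    m * (e′ + d)     ≡⟨ *-distribˡ-+ m e′ d ⟩
    m * e′ + m * d   ≤⟨ +-monoˡ-≤ (m * d) m*e′≤ ⟩
    s * d + m * d    ≡⟨ *-distribʳ-+ d s m ⟨
    (s + m) * d      ∎)
  where open ≤-Reasoning

𝟙 : Bool → ℕ
𝟙 true  = 1
𝟙 false = 0

𝟙≤1 : ∀ b → 𝟙 b ≤ 1
𝟙≤1 true  = ≤-refl
𝟙≤1 false = z≤n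

𝟙-pos : ∀ {b} → 1 ≤ 𝟙 b → b ≡ true
𝟙-pos {true} _ = refl

∧-true : ∀ {x y} → x ∧ y ≡ true → x ≡ true × y ≡ true
∧-true {true} {true} _ = refl , refl

<ᵇ-true⇒< : ∀ {m n} → (m <ᵇ n) ≡ true → m < n
<ᵇ-true⇒< {m} {n} m<ᵇn = <ᵇ⇒< m n (Equivalence.from T-≡ m<ᵇn)

<⇒<ᵇ-true : ∀ {m n} → m < n → (m <ᵇ n) ≡ true
<⇒<ᵇ-true m<n = Equivalence.to T-≡ (<⇒<ᵇ m<n)

not-<ᵇ-true⇒≮ : ∀ {m n} → not (m <ᵇ n) ≡ true → ¬ m < n
not-<ᵇ-true⇒≮ m≮ᵇn m<n = contradiction (trans (sym (cong not (<⇒<ᵇ-true m<n))) m≮ᵇn) λ ()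

sum-mono-≤ : ∀ {n} {f g : Fin n → ℕ} → (∀ i → f i ≤ g i) → sum f ≤ sum g
sum-mono-≤ {zero}  f≤g = z≤n
sum-mono-≤ {suc n} f≤g = +-mono-≤ (f≤g zero) (sum-mono-≤ (f≤g ∘ suc))

sum-zero : ∀ {n} {f : Fin n → ℕ} → (∀ i → f i ≡ 0) → sum f ≡ 0
sum-zero {n} f≡0 = trans (sum-cong-≗ f≡0) (sum-replicate-zero n)

lookup≤sum : ∀ {n} (f : Fin n → ℕ) i → f i ≤ sum f
lookup≤sum f zero    = m≤m+n (f zero) _
lookup≤sum f (suc i) = ≤-trans (lookup≤sum (f ∘ suc) i) (m≤n+m _ (f zero))

lookup+lookup≤sum : ∀ {n} (f : Fin n → ℕ) {i j} → i ≢ j → f i + f j ≤ sum f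
lookup+lookup≤sum f {zero}  {zero}  i≢j = contradiction refl i≢j
lookup+lookup≤sum f {zero}  {suc j} _   = +-monoʳ-≤ (f zero) (lookup≤sum (f ∘ suc) j)
lookup+lookup≤sum f {suc i} {zero}  _   =
  subst (_≤ sum f) (+-comm (f zero) _) (+-monoʳ-≤ (f zero) (lookup≤sum (f ∘ suc) i))
lookup+lookup≤sum f {suc i} {suc j} i≢j =
  ≤-trans (lookup+lookup≤sum (f ∘ suc) (i≢j ∘ cong suc)) (m≤n+m _ (f zero))

sum-pos : ∀ {n} (f : Fin n → ℕ) → 1 ≤ sum f → ∃ λ i → 1 ≤ f i
sum-pos {suc n} f sum≥1 with f zero in f₀
... | suc _ = zero , subst (1 ≤_) (sym f₀) (s≤s z≤n)
... | zero  with sum-pos (f ∘ suc) sum≥1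
...   | i , fᵢ≥1 = suc i , fᵢ≥1

sum≤1 : ∀ {n} (f : Fin n → ℕ) → (∀ i → f i ≤ 1) → (∀ i j → 1 ≤ f i → 1 ≤ f j → i ≡ j) → sum f ≤ 1
sum≤1 {zero}  f _   _      = z≤n
sum≤1 {suc n} f f≤1 unique with 1 ≤? f zero
... | no  f₀≱1 = ≤-trans (+-monoˡ-≤ _ (≤-pred (≰⇒> f₀≱1)))
                   (sum≤1 (f ∘ suc) (f≤1 ∘ suc) (λ i j p q → Fin.suc-injective (unique (suc i) (suc j) p q)))
... | yes f₀≥1 =
  subst (λ x → f zero + x ≤ 1) (sym (sum-zero tail≡0)) (subst (_≤ 1) (sym (+-identityʳ _)) (f≤1 zero))
  where
  tail≡0 : ∀ i → f (suc i) ≡ 0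
  tail≡0 i with 1 ≤? f (suc i)
  ... | yes fᵢ≥1 = contradiction (unique zero (suc i) f₀≥1 fᵢ≥1) λ ()
  ... | no  fᵢ≱1 = n<1⇒n≡0 (≰⇒> fᵢ≱1)

count : ∀ {n} → (Fin n → Bool) → ℕ
count P = sum (𝟙 ∘ P)

count-true : ∀ n → count {n} (λ _ → true) ≡ n
count-true zero    = refl
count-true (suc n) = cong suc (count-true n)

count-split : ∀ {n} (c P : Fin n → Bool) → count P ≡ count (λ x → c x ∧ P x) + count (λ x → not (c x) ∧ P x)
count-split {n} c P = trans (sum-cong-≗ λ x → 𝟙-split (c x) (P x)) (∑-distrib-+ {n} _ _)
  where
  𝟙-split : ∀ c b → 𝟙 b ≡ 𝟙 (c ∧ b) + 𝟙 (not c ∧ b)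
  𝟙-split true  b = sym (+-identityʳ (𝟙 b))
  𝟙-split false b = refl

count+count-not : ∀ {n} (P : Fin n → Bool) → count P + count (not ∘ P) ≡ n
count+count-not {n} P = begin
  count P + count (not ∘ P)             ≡⟨ ∑-distrib-+ (𝟙 ∘ P) (𝟙 ∘ not ∘ P) ⟨
  sum (λ x → 𝟙 (P x) + 𝟙 (not (P x)))   ≡⟨ sum-cong-≗ (𝟙+𝟙-not ∘ P) ⟩
  count {n} (λ _ → true)                ≡⟨ count-true n ⟩
  n                                     ∎
  where
  open ≡-Reasoning
  𝟙+𝟙-not : ∀ b → 𝟙 b + 𝟙 (not b) ≡ 1
  𝟙+𝟙-not true  = refl
  𝟙+𝟙-not false = refl

count-<ᵇ : ∀ n i → count {n} (λ j → toℕ j <ᵇ i) ≡ n ⊓ i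
count-<ᵇ zero    i       = refl
count-<ᵇ (suc n) zero    = sum-zero {n} λ _ → refl
count-<ᵇ (suc n) (suc i) = cong suc (count-<ᵇ n i)

count-lookup : ∀ {n} (P : Fin n → Bool) {x} → P x ≡ true → 1 ≤ count P
count-lookup P {x} Px = ≤-trans (≤-reflexive (cong 𝟙 (sym Px))) (lookup≤sum (𝟙 ∘ P) x)

count-lookup₂ : ∀ {n} (P : Fin n → Bool) {x y} → x ≢ y → P x ≡ true → P y ≡ true → 2 ≤ count P
count-lookup₂ P {x} {y} x≢y Px Py =
  ≤-trans (≤-reflexive (cong₂ (λ a b → 𝟙 a + 𝟙 b) (sym Px) (sym Py))) (lookup+lookup≤sum (𝟙 ∘ P) x≢y)

𝟙-any≤count : ∀ {n} (P : Fin n → Bool) → 𝟙 (any P (allFin n)) ≤ count P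
𝟙-any≤count P = go P id
  where
  go : ∀ {A : Set} {n} (P : A → Bool) (h : Fin n → A) → 𝟙 (any P (tabulate h)) ≤ sum (λ j → 𝟙 (P (h j)))
  go {n = zero}  P h = z≤n
  go {n = suc n} P h with P (h zero)
  ... | true  = s≤s z≤n
  ... | false = go P (h ∘ suc)

any-allFin : ∀ {n} (P : Fin n → Bool) j → P j ≡ true → any P (allFin n) ≡ true
any-allFin P j Pj = Equivalence.to T-≡ (any⁺ P (lose (∈-allFin j) (Equivalence.from T-≡ Pj)))

countTrue-++ : ∀ xs ys → countTrue (xs ++ ys) ≡ countTrue xs + countTrue ys
countTrue-++ []           ys = refl
countTrue-++ (true ∷ xs)  ys = cong suc (countTrue-++ xs ys)
countTrue-++ (false ∷ xs) ys = countTrue-++ xs ys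

countTrue-tabulate : ∀ {n} (P : Fin n → Bool) → countTrue (tabulate P) ≡ count P
countTrue-tabulate {zero}  P = refl
countTrue-tabulate {suc n} P with P zero
... | true  = cong suc (countTrue-tabulate (P ∘ suc))
... | false = countTrue-tabulate (P ∘ suc)

countTrue-concat-tabulate : ∀ {n} (L : Fin n → List Bool) → countTrue (concat (tabulate L)) ≡ sum (countTrue ∘ L)
countTrue-concat-tabulate {zero}  L = refl
countTrue-concat-tabulate {suc n} L =
  trans (countTrue-++ (L zero) _) (cong (countTrue (L zero) +_) (countTrue-concat-tabulate (L ∘ suc)))

pairCount : ∀ {n} → (Fin n → Fin n → Bool) → ℕ
pairCount r = sum (λ u → sum (λ w → 𝟙 ((toℕ u <ᵇ toℕ w) ∧ r u w)))

v≡count : ∀ {n} (G : Graph n) → v G ≡ count (V G)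
v≡count G = trans (cong countTrue (map-tabulate id (V G))) (countTrue-tabulate (V G))

e≡pairCount : ∀ {n} (G : Graph n) → e G ≡ pairCount (E G)
e≡pairCount {n} G = begin
  countTrue (map g (pairs n))                        ≡⟨ cong countTrue (map-concatMap g row (allFin n)) ⟩
  countTrue (concat (map (map g ∘ row) (allFin n)))  ≡⟨ cong (countTrue ∘ concat) (map-tabulate id (map g ∘ row)) ⟩
  countTrue (concat (tabulate (map g ∘ row)))        ≡⟨ countTrue-concat-tabulate (map g ∘ row) ⟩
  sum (λ u → countTrue (map g (row u)))              ≡⟨ sum-cong-≗ row-count ⟩
  pairCount (E G)                                    ∎
  where
  open ≡-Reasoning
  g : Fin n × Fin n → Bool
  g (u , w) = (toℕ u <ᵇ toℕ w) ∧ E G u w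
  row : Fin n → List (Fin n × Fin n)
  row u = map (u ,_) (allFin n)
  row-count : ∀ u → countTrue (map g (row u)) ≡ count (λ w → g (u , w))
  row-count u = begin
    countTrue (map g (map (u ,_) (tabulate id)))  ≡⟨ cong (countTrue ∘ map g) (map-tabulate id (u ,_)) ⟩
    countTrue (map g (tabulate (u ,_)))           ≡⟨ cong countTrue (map-tabulate (u ,_) g) ⟩
    countTrue (tabulate (λ w → g (u , w)))        ≡⟨ countTrue-tabulate (λ w → g (u , w)) ⟩
    count (λ w → g (u , w))                       ∎

pairCount-cong : ∀ {n} {r r′ : Fin n → Fin n → Bool}
               → (∀ u w → toℕ u < toℕ w → r u w ≡ r′ u w) → pairCount r ≡ pairCount r′
pairCount-cong {r = r} {r′} r≡r′ = sum-cong-≗ λ u → sum-cong-≗ λ w → guarded u w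
  where
  guarded : ∀ u w → 𝟙 ((toℕ u <ᵇ toℕ w) ∧ r u w) ≡ 𝟙 ((toℕ u <ᵇ toℕ w) ∧ r′ u w)
  guarded u w with toℕ u <ᵇ toℕ w in u<w
  ... | false = refl
  ... | true  = cong 𝟙 (r≡r′ u w (<ᵇ-true⇒< u<w))

pairCount-mono : ∀ {n} {r r′ : Fin n → Fin n → Bool}
               → (∀ u w → toℕ u < toℕ w → r u w ≡ true → r′ u w ≡ true) → pairCount r ≤ pairCount r′
pairCount-mono {r = r} {r′} r⇒r′ = sum-mono-≤ λ u → sum-mono-≤ λ w → guarded u w
  where
  guarded : ∀ u w → 𝟙 ((toℕ u <ᵇ toℕ w) ∧ r u w) ≤ 𝟙 ((toℕ u <ᵇ toℕ w) ∧ r′ u w)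
  guarded u w with toℕ u <ᵇ toℕ w in u<w | r u w in ruw
  ... | false | _     = z≤n
  ... | true  | false = z≤n
  ... | true  | true  = ≤-reflexive (cong 𝟙 (sym (r⇒r′ u w (<ᵇ-true⇒< u<w) ruw)))

pairCount-false : ∀ {n} {r : Fin n → Fin n → Bool} → (∀ u w → toℕ u < toℕ w → r u w ≡ false) → pairCount r ≡ 0
pairCount-false {n} r≡false =
  trans (pairCount-cong r≡false) (sum-zero {n} λ u → sum-zero {n} λ w → cong 𝟙 (∧-zeroʳ _))

pairCount-split : ∀ {n} (c r : Fin n → Fin n → Bool)
                → pairCount r ≡ pairCount (λ u w → c u w ∧ r u w) + pairCount (λ u w → not (c u w) ∧ r u w)
pairCount-split {n} c r = begin
  pairCount r                       ≡⟨ sum-cong-≗ (λ u → trans (sum-cong-≗ (split u)) (∑-distrib-+ {n} _ _)) ⟩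
  sum (λ u → inside u + outside u)  ≡⟨ ∑-distrib-+ inside outside ⟩
  sum inside + sum outside          ∎
  where
  open ≡-Reasoning
  inside outside : Fin n → ℕ
  inside  u = sum (λ w → 𝟙 ((toℕ u <ᵇ toℕ w) ∧ (c u w ∧ r u w)))
  outside u = sum (λ w → 𝟙 ((toℕ u <ᵇ toℕ w) ∧ (not (c u w) ∧ r u w)))
  𝟙-split : ∀ b c r → 𝟙 (b ∧ r) ≡ 𝟙 (b ∧ (c ∧ r)) + 𝟙 (b ∧ (not c ∧ r))
  𝟙-split false _     _ = refl
  𝟙-split true  true  r = sym (+-identityʳ (𝟙 r))
  𝟙-split true  false r = refl
  split : ∀ u w → _
  split u w = 𝟙-split (toℕ u <ᵇ toℕ w) (c u w) (r u w)

pairCount-lookup : ∀ {n} (r : Fin n → Fin n → Bool) {u w} → toℕ u < toℕ w → r u w ≡ true → 1 ≤ pairCount r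
pairCount-lookup r {u} {w} u<w ruw = begin
  1                                           ≡⟨ cong 𝟙 (cong₂ _∧_ (<⇒<ᵇ-true u<w) ruw) ⟨
  row u w                                     ≤⟨ lookup≤sum (row u) w ⟩
  sum (row u)                                 ≤⟨ lookup≤sum (sum ∘ row) u ⟩
  pairCount r                                 ∎
  where
  open ≤-Reasoning
  row : _ → _ → ℕ
  row u w = 𝟙 ((toℕ u <ᵇ toℕ w) ∧ r u w)

pairCount≤1 : ∀ {n} (r : Fin n → Fin n → Bool)
            → (∀ u w u′ w′ → toℕ u < toℕ w → toℕ u′ < toℕ w′ → r u w ≡ true → r u′ w′ ≡ true → u ≡ u′ × w ≡ w′)
            → pairCount r ≤ 1
pairCount≤1 r unique = sum≤1 (sum ∘ term) row≤1 λ u u′ p q → proj₁ (term-unique (proj₂ (sum-pos (term u) p))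
                                                                                (proj₂ (sum-pos (term u′) q)))
  where
  term : _ → _ → ℕ
  term u w = 𝟙 ((toℕ u <ᵇ toℕ w) ∧ r u w)
  term-unique : ∀ {u w u′ w′} → 1 ≤ term u w → 1 ≤ term u′ w′ → u ≡ u′ × w ≡ w′
  term-unique {u} {w} {u′} {w′} p q with ∧-true (𝟙-pos p) | ∧-true (𝟙-pos q)
  ... | u<w , ruw | u′<w′ , ru′w′ = unique u w u′ w′ (<ᵇ-true⇒< u<w) (<ᵇ-true⇒< u′<w′) ruw ru′w′
  row≤1 : ∀ u → sum (term u) ≤ 1
  row≤1 u = sum≤1 (term u) (λ w → 𝟙≤1 _) λ w w′ p q → proj₂ (term-unique p q)

pairCount-both : ∀ {n} (S : Fin n → Bool) → pairCount (λ u w → S u ∧ S w) ≡ count S C 2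
pairCount-both {zero}  S = refl
pairCount-both {suc n} S with S zero
... | true  = trans (cong (count (S ∘ suc) +_) (pairCount-both (S ∘ suc))) (sym ([1+n]C2≡n+nC2 (count (S ∘ suc))))
... | false = cong₂ _+_ (sum-zero {n} λ _ → refl) (pairCount-both (S ∘ suc))

nonEdge : ∀ {n} → Graph n → Fin n → Fin n → Bool
nonEdge G u w = (V G u ∧ V G w) ∧ not (E G u w)

nonEdges : ∀ {n} → Graph n → ℕ
nonEdges G = pairCount (nonEdge G)

nonEdgesLeaving : ∀ {n} → Graph n → (Fin n → Bool) → ℕ
nonEdgesLeaving G S = pairCount (λ u w → not (S u ∧ S w) ∧ nonEdge G u w)

module _ {n} {G : Graph n} (wf : WellFormed G) where
  open WellFormed wf

  e+nonEdges≡vC2 : e G + nonEdges G ≡ v G C 2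
  e+nonEdges≡vC2 = begin
    e G + nonEdges G
      ≡⟨ cong₂ _+_ (trans (e≡pairCount G) (pairCount-cong λ u w _ → edge⇒both u w))
                   (pairCount-cong λ u w _ → ∧-comm (both u w) _) ⟩
    pairCount (λ u w → E G u w ∧ both u w) + pairCount (λ u w → not (E G u w) ∧ both u w)
      ≡⟨ pairCount-split (E G) both ⟨
    pairCount both       ≡⟨ pairCount-both (V G) ⟩
    count (V G) C 2      ≡⟨ cong (_C 2) (v≡count G) ⟨
    v G C 2              ∎
    where
    open ≡-Reasoning
    both : Fin n → Fin n → Bool
    both u w = V G u ∧ V G w
    edge⇒both : ∀ u w → E G u w ≡ E G u w ∧ both u w
    edge⇒both u w with E G u w in uw
    ... | false = refl
    ... | true  rewrite E-V u w uw | E-V w u (trans (E-sym w u) uw) = refl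

  nonEdges≡0⇒isClique : nonEdges G ≡ 0 → IsClique G
  nonEdges≡0⇒isClique none = clique
    where
    adjacent : ∀ {u w} → toℕ u < toℕ w → V G u ≡ true → V G w ≡ true → E G u w ≡ true
    adjacent {u} {w} u<w u∈G w∈G with E G u w in uw
    ... | true  = refl
    ... | false = contradiction (subst (1 ≤_) none (pairCount-lookup (nonEdge G) u<w nonEdge-uw)) λ ()
      where
      nonEdge-uw : nonEdge G u w ≡ true
      nonEdge-uw rewrite u∈G | w∈G | uw = refl
    clique : IsClique G
    clique u w u≢w u∈G w∈G with <-cmp (toℕ u) (toℕ w)
    ... | tri< u<w _ _ = adjacent u<w u∈G w∈G
    ... | tri≈ _ u≡w _ = contradiction (Fin.toℕ-injective u≡w) u≢w
    ... | tri> _ _ w<u = trans (E-sym u w) (adjacent w<u w∈G u∈G)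

isClique⇒nonEdges≡0 : ∀ {n} {G : Graph n} → IsClique G → nonEdges G ≡ 0
isClique⇒nonEdges≡0 {G = G} clique = pairCount-false no-nonEdge
  where
  no-nonEdge : ∀ u w → toℕ u < toℕ w → nonEdge G u w ≡ false
  no-nonEdge u w u<w with V G u in u∈G | V G w in w∈G
  ... | false | _     = refl
  ... | true  | false = refl
  ... | true  | true  rewrite clique u w (λ u≡w → <-irrefl (cong toℕ u≡w) u<w) u∈G w∈G = refl

isClique⇒e≡vC2 : ∀ {n} {G : Graph n} → WellFormed G → IsClique G → e G ≡ v G C 2
isClique⇒e≡vC2 {G = G} wf clique = begin
  e G                ≡⟨ +-identityʳ (e G) ⟨
  e G + 0            ≡⟨ cong (e G +_) (isClique⇒nonEdges≡0 clique) ⟨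
  e G + nonEdges G   ≡⟨ e+nonEdges≡vC2 wf ⟩
  v G C 2            ∎
  where open ≡-Reasoning

sameGraph⇒v≡ : ∀ {n} {G G′ : Graph n} → SameGraph G G′ → v G ≡ v G′
sameGraph⇒v≡ {G = G} {G′} (V≡ , _) =
  trans (v≡count G) (trans (sum-cong-≗ (cong 𝟙 ∘ V≡)) (sym (v≡count G′)))

sameGraph⇒e≡ : ∀ {n} {G G′ : Graph n} → SameGraph G G′ → e G ≡ e G′
sameGraph⇒e≡ {G = G} {G′} (_ , E≡) =
  trans (e≡pairCount G) (trans (pairCount-cong λ u w _ → E≡ u w) (sym (e≡pairCount G′)))

⊆G-refl : ∀ {n} {G : Graph n} → WellFormed G → G ⊆G G
⊆G-refl wf = record { wf = wf ; V⊆ = λ _ p → p ; E⊆ = λ _ _ p → p }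

v+missing≡n : ∀ {n} (G : Graph n) → v G + count (not ∘ V G) ≡ n
v+missing≡n G = trans (cong (_+ count (not ∘ V G)) (v≡count G)) (count+count-not (V G))

nonEdges-⊆ : ∀ {n} {H′ H : Graph n} → H′ ⊆G H → nonEdges H ≤ nonEdges H′ + nonEdgesLeaving H (V H′)
nonEdges-⊆ {H′ = H′} {H} H′⊆H = begin
  nonEdges H
    ≡⟨ pairCount-split (λ u w → V H′ u ∧ V H′ w) (nonEdge H) ⟩
  pairCount (λ u w → (V H′ u ∧ V H′ w) ∧ nonEdge H u w) + nonEdgesLeaving H (V H′)
    ≤⟨ +-monoˡ-≤ _ (pairCount-mono inside) ⟩
  nonEdges H′ + nonEdgesLeaving H (V H′)
    ∎
  where
  open ≤-Reasoning
  open _⊆G_ H′⊆H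
  inside : ∀ u w → toℕ u < toℕ w → (V H′ u ∧ V H′ w) ∧ nonEdge H u w ≡ true → nonEdge H′ u w ≡ true
  inside u w _ p with ∧-true p
  ... | u,w∈H′ , uw∉H with E H′ u w in uw
  ... | false = cong (_∧ true) u,w∈H′
  ... | true  rewrite E⊆ u w uw = contradiction (trans (sym (∧-zeroʳ (V H u ∧ V H w))) uw∉H) λ ()

¬InI⇒e<vC2 : ∀ {n} {H H′ : Graph n} → H′ ⊆G H → ¬ InI H H′ → e H′ < e H → e H′ < v H′ C 2
¬InI⇒e<vC2 {H = H} {H′} H′⊆H ¬I e′<e with nonEdges H′ ℕ.≟ 0
... | yes none = ⊥-elim (¬I (H′⊆H , (λ same → <-irrefl (sameGraph⇒e≡ same) e′<e) , nonEdges≡0⇒isClique wf none))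
  where open _⊆G_ H′⊆H
... | no  some = begin-strict
  e H′                 <⟨ m<m+n (e H′) (n≢0⇒n>0 some) ⟩
  e H′ + nonEdges H′   ≡⟨ e+nonEdges≡vC2 wf ⟩
  v H′ C 2             ∎
  where
  open ≤-Reasoning
  open _⊆G_ H′⊆H

twoIsolated : ∀ {n} → Graph n
twoIsolated = mkGraph (λ u → toℕ u <ᵇ 2) (λ _ _ → false)

v-twoIsolated : ∀ {n} → 2 ≤ n → v (twoIsolated {n}) ≡ 2
v-twoIsolated {n} n≥2 = trans (v≡count (twoIsolated {n})) (trans (count-<ᵇ n 2) (m≥n⇒m⊓n≡n n≥2))

e-twoIsolated : ∀ {n} → e (twoIsolated {n}) ≡ 0
e-twoIsolated {n} = trans (e≡pairCount (twoIsolated {n})) (pairCount-false {n} λ _ _ _ → refl)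

twoIsolated-¬clique : ∀ {n} → 2 ≤ n → ¬ IsClique (twoIsolated {n})
twoIsolated-¬clique {1} (s≤s ())
twoIsolated-¬clique {suc (suc n)} _ clique = contradiction (clique zero (suc zero) (λ ()) refl refl) λ ()

twoIsolated⊆ : ∀ {n} {H : Graph n} → (∀ u → V H u ≡ true) → twoIsolated ⊆G H
twoIsolated⊆ all∈H = record
  { wf = record { E-sym = λ _ _ → refl ; E-irr = λ _ → refl ; E-V = λ _ _ () }
  ; V⊆ = λ u _ → all∈H u
  ; E⊆ = λ _ _ ()
  }

_∈ᵉ_ : ∀ {k} → Fin k → Edge k → Bool
x ∈ᵉ (a , b) = ⌊ x ≟ a ⌋ ∨ ⌊ x ≟ b ⌋

≟-refl : ∀ {k} (x : Fin k) → ⌊ x ≟ x ⌋ ≡ true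
≟-refl x = trans (isYes≗does (x ≟ x)) (dec-true (x ≟ x) refl)

∈ᵉ-fst : ∀ {k} (a b : Fin k) → a ∈ᵉ (a , b) ≡ true
∈ᵉ-fst a b rewrite ≟-refl a = refl

∈ᵉ-snd : ∀ {k} (a b : Fin k) → b ∈ᵉ (a , b) ≡ true
∈ᵉ-snd a b rewrite ≟-refl b = ∨-zeroʳ _

∈ᵉ-sound : ∀ {k} {x a b : Fin k} → x ∈ᵉ (a , b) ≡ true → x ≡ a ⊎ x ≡ b
∈ᵉ-sound {x = x} {a} {b} _ with x ≟ a | x ≟ b
... | yes x≡a | _       = inj₁ x≡a
... | no  _   | yes x≡b = inj₂ x≡b

vertexDisjoint⇒¬shared : ∀ {k} {ed ed′ : Edge k} → VertexDisjoint ed ed′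
                       → ∀ x → x ∈ᵉ ed ≡ true → x ∈ᵉ ed′ ≡ true → ⊥
vertexDisjoint⇒¬shared {ed = a , b} {c , d} (a≢c , a≢d , b≢c , b≢d) x x∈ed x∈ed′
  with ∈ᵉ-sound {x = x} {a} {b} x∈ed | ∈ᵉ-sound {x = x} {c} {d} x∈ed′
... | inj₁ refl | inj₁ refl = a≢c refl
... | inj₁ refl | inj₂ refl = a≢d refl
... | inj₂ refl | inj₁ refl = b≢c refl
... | inj₂ refl | inj₂ refl = b≢d refl

sameEdgeᵇ-sound : ∀ {k} {a b u w : Fin k} → sameEdgeᵇ (a , b) u w ≡ true → SameEdge (a , b) (u , w)
sameEdgeᵇ-sound {a = a} {b} {u} {w} _ with a ≟ u | b ≟ w | a ≟ w | b ≟ u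
... | yes a≡u | yes b≡w | _       | _       = inj₁ (a≡u , b≡w)
... | yes _   | no  _   | yes a≡w | yes b≡u = inj₂ (a≡w , b≡u)
... | no  _   | _       | yes a≡w | yes b≡u = inj₂ (a≡w , b≡u)

sameEdgeᵇ-refl : ∀ {k} (a b : Fin k) → sameEdgeᵇ (a , b) a b ≡ true
sameEdgeᵇ-refl a b rewrite ≟-refl a | ≟-refl b = refl

sameEdgeᵇ-sym : ∀ {k} (ed : Edge k) u w → sameEdgeᵇ ed u w ≡ sameEdgeᵇ ed w u
sameEdgeᵇ-sym (a , b) u w = ∨-comm (⌊ a ≟ u ⌋ ∧ ⌊ b ≟ w ⌋) _

pairCount-sameEdge≤1 : ∀ {k} (ed : Edge k) → pairCount (sameEdgeᵇ ed) ≤ 1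
pairCount-sameEdge≤1 (a , b) = pairCount≤1 (sameEdgeᵇ (a , b)) unique
  where
  unique : ∀ u w u′ w′ → toℕ u < toℕ w → toℕ u′ < toℕ w′
         → sameEdgeᵇ (a , b) u w ≡ true → sameEdgeᵇ (a , b) u′ w′ ≡ true → u ≡ u′ × w ≡ w′
  unique u w u′ w′ u<w u′<w′ p q
    with sameEdgeᵇ-sound {a = a} {b} {u} {w} p | sameEdgeᵇ-sound {a = a} {b} {u′} {w′} q
  ... | inj₁ (refl , refl) | inj₁ (refl , refl) = refl , refl
  ... | inj₂ (refl , refl) | inj₂ (refl , refl) = refl , refl
  ... | inj₁ (refl , refl) | inj₂ (refl , refl) = contradiction u<w (<-asym u′<w′)
  ... | inj₂ (refl , refl) | inj₁ (refl , refl) = contradiction u<w (<-asym u′<w′)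

pairCount-sameEdge : ∀ {k} (c : Fin k → Fin k → Bool) → (∀ u w → c u w ≡ c w u) → ∀ a b
                   → pairCount (λ u w → c u w ∧ sameEdgeᵇ (a , b) u w) ≤ 𝟙 (c a b)
pairCount-sameEdge c c-sym a b with c a b in cab
... | true  = ≤-trans (pairCount-mono {r′ = sameEdgeᵇ (a , b)} λ _ _ _ p → proj₂ (∧-true p))
                      (pairCount-sameEdge≤1 (a , b))
... | false = ≤-reflexive (pairCount-false outside)
  where
  outside : ∀ u w → toℕ u < toℕ w → c u w ∧ sameEdgeᵇ (a , b) u w ≡ false
  outside u w _ with sameEdgeᵇ (a , b) u w in same
  ... | false = ∧-zeroʳ (c u w)
  ... | true with sameEdgeᵇ-sound {a = a} {b} {u} {w} same
  ...   | inj₁ (refl , refl) = trans (∧-comm _ true) cab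
  ...   | inj₂ (refl , refl) = trans (∧-comm _ true) (trans (c-sym u w) cab)

pairCount-removal : ∀ {k m} (es : Fin m → Edge k) (sel : Fin m → Bool) (c : Fin k → Fin k → Bool)
                  → (∀ u w → c u w ≡ c w u)
                  → pairCount (λ u w → c u w ∧ any (λ j → sel j ∧ sameEdgeᵇ (es j) u w) (allFin m))
                    ≤ count (λ j → c (proj₁ (es j)) (proj₂ (es j)) ∧ sel j)
pairCount-removal {k} {m} es sel c c-sym = begin
  pairCount (λ u w → c u w ∧ any (P u w) (allFin m))
    ≤⟨ sum-mono-≤ (λ u → sum-mono-≤ λ w → union-bound u w) ⟩
  sum (λ u → sum (λ w → sum (λ j → term j u w)))
    ≡⟨ sum-cong-≗ (λ u → ∑-comm (λ w j → term j u w)) ⟩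
  sum (λ u → sum (λ j → sum (λ w → term j u w)))
    ≡⟨ ∑-comm (λ u j → sum (λ w → term j u w)) ⟩
  sum (λ j → pairCount (λ u w → (c u w ∧ sel j) ∧ sameEdgeᵇ (es j) u w))
    ≤⟨ sum-mono-≤ (λ j → pairCount-sameEdge (λ u w → c u w ∧ sel j) (λ u w → cong (_∧ sel j) (c-sym u w))
                                             (proj₁ (es j)) (proj₂ (es j))) ⟩
  count (λ j → c (proj₁ (es j)) (proj₂ (es j)) ∧ sel j)
    ∎
  where
  open ≤-Reasoning
  P : Fin k → Fin k → Fin m → Bool
  P u w j = sel j ∧ sameEdgeᵇ (es j) u w
  term : Fin m → Fin k → Fin k → ℕ
  term j u w = 𝟙 ((toℕ u <ᵇ toℕ w) ∧ ((c u w ∧ sel j) ∧ sameEdgeᵇ (es j) u w))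
  union-bound : ∀ u w → 𝟙 ((toℕ u <ᵇ toℕ w) ∧ (c u w ∧ any (P u w) (allFin m))) ≤ sum (λ j → term j u w)
  union-bound u w with toℕ u <ᵇ toℕ w | c u w
  ... | false | _     = z≤n
  ... | true  | false = z≤n
  ... | true  | true  = 𝟙-any≤count (P u w)

IsMatchingOn : ∀ {m k} → (Fin m → Edge k) → (Fin m → Bool) → Set
IsMatchingOn es c = ∀ j j′ → j ≢ j′ → c j ≡ true → c j′ ≡ true → VertexDisjoint (es j) (es j′)

matching-incident≤1 : ∀ {m k} {es : Fin m → Edge k} {c} → IsMatchingOn es c
                    → ∀ x → count (λ j → c j ∧ x ∈ᵉ es j) ≤ 1
matching-incident≤1 {es = es} {c} matching x = sum≤1 _ (λ j → 𝟙≤1 _) unique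
  where
  unique : ∀ j j′ → 1 ≤ 𝟙 (c j ∧ x ∈ᵉ es j) → 1 ≤ 𝟙 (c j′ ∧ x ∈ᵉ es j′) → j ≡ j′
  unique j j′ p q with j Fin.≟ j′ | ∧-true (𝟙-pos p) | ∧-true (𝟙-pos q)
  ... | yes j≡j′ | _             | _               = j≡j′
  ... | no  j≢j′ | cj , x∈es-j   | cj′ , x∈es-j′   =
    contradiction x∈es-j′ (vertexDisjoint⇒¬shared (matching j j′ j≢j′ cj cj′) x x∈es-j)

two-matchings-incident≤2 : ∀ {m k} {es : Fin m → Edge k} {c} → IsMatchingOn es c → IsMatchingOn es (not ∘ c)
                         → ∀ x → count (λ j → x ∈ᵉ es j) ≤ 2
two-matchings-incident≤2 {c = c} M₁ M₂ x =
  ≤-trans (≤-reflexive (count-split c _)) (+-mono-≤ (matching-incident≤1 M₁ x) (matching-incident≤1 M₂ x))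

module Deletion (k : ℕ) (es : Fin (k ∸ 2) → Edge k) (i : ℕ) where

  H : Graph k
  H = Hgraph k es i

  chosen : Fin (k ∸ 2) → Bool
  chosen j = toℕ j <ᵇ i

  removed : Fin k → Fin k → Bool
  removed u w = any (λ j → chosen j ∧ sameEdgeᵇ (es j) u w) (allFin (k ∸ 2))

  lowHalf : Fin (k ∸ 2) → Bool
  lowHalf j = toℕ j <ᵇ k / 2

  H-wellFormed : WellFormed H
  H-wellFormed = record
    { E-sym = λ u w → cong₂ (λ x y → not x ∧ not y) (≟-sym u w) (removed-sym u w)
    ; E-irr = λ u → cong (λ x → not x ∧ not (removed u u)) (≟-refl u)
    ; E-V   = λ _ _ _ → refl
    }
    where
    ≟-sym : ∀ u w → ⌊ u ≟ w ⌋ ≡ ⌊ w ≟ u ⌋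
    ≟-sym u w with u ≟ w | w ≟ u
    ... | yes _   | yes _   = refl
    ... | no  _   | no  _   = refl
    ... | yes u≡w | no  w≢u = contradiction (sym u≡w) w≢u
    ... | no  u≢w | yes w≡u = contradiction (sym w≡u) u≢w
    removed-sym : ∀ u w → removed u w ≡ removed w u
    removed-sym u w = cong or (map-cong (λ j → cong (chosen j ∧_) (sameEdgeᵇ-sym (es j) u w)) (allFin (k ∸ 2)))

  v-H : v H ≡ k
  v-H = trans (v≡count H) (count-true k)

  e-H+nonEdges : e H + nonEdges H ≡ k C 2
  e-H+nonEdges = trans (e+nonEdges≡vC2 H-wellFormed) (cong (_C 2) v-H)

  nonEdge-H : ∀ u w → toℕ u < toℕ w → nonEdge H u w ≡ removed u w
  nonEdge-H u w u<w with u ≟ w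
  ... | yes u≡w = contradiction (cong toℕ u≡w) (<⇒≢ u<w)
  ... | no  _   = not-involutive (removed u w)

  nonEdges-H≤i : nonEdges H ≤ i
  nonEdges-H≤i = begin
    nonEdges H                             ≡⟨ pairCount-cong nonEdge-H ⟩
    pairCount (λ u w → true ∧ removed u w) ≤⟨ pairCount-removal es chosen (λ _ _ → true) (λ _ _ → refl) ⟩
    count chosen                           ≡⟨ count-<ᵇ (k ∸ 2) i ⟩
    (k ∸ 2) ⊓ i                            ≤⟨ m⊓n≤n (k ∸ 2) i ⟩
    i                                      ∎
    where open ≤-Reasoning

  nonEdgesLeaving-H : IsMatchingOn es lowHalf → IsMatchingOn es (not ∘ lowHalf)
                    → ∀ S → nonEdgesLeaving H S ≤ 2 * count (not ∘ S)
  nonEdgesLeaving-H M₁ M₂ S = begin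
    nonEdgesLeaving H S
      ≡⟨ pairCount-cong (λ u w u<w → cong (leaves u w ∧_) (nonEdge-H u w u<w)) ⟩
    pairCount (λ u w → leaves u w ∧ removed u w)
      ≤⟨ pairCount-removal es chosen leaves (λ u w → cong not (∧-comm (S u) (S w))) ⟩
    count (λ j → leaves (proj₁ (es j)) (proj₂ (es j)) ∧ chosen j)
      ≤⟨ sum-mono-≤ (λ j → edge-leaves (proj₁ (es j)) (proj₂ (es j)) (chosen j)) ⟩
    sum (λ j → count (outsideEnd (es j)))
      ≡⟨ ∑-comm (λ j x → 𝟙 (not (S x) ∧ x ∈ᵉ es j)) ⟩
    sum (λ x → count (λ j → not (S x) ∧ x ∈ᵉ es j))
      ≤⟨ sum-mono-≤ vertex-bound ⟩
    sum (λ x → 2 * 𝟙 (not (S x)))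
      ≡⟨ *-distribˡ-sum 2 (𝟙 ∘ not ∘ S) ⟨
    2 * count (not ∘ S)
      ∎
    where
    open ≤-Reasoning
    leaves : Fin k → Fin k → Bool
    leaves u w = not (S u ∧ S w)
    outsideEnd : Edge k → Fin k → Bool
    outsideEnd ed x = not (S x) ∧ x ∈ᵉ ed
    edge-leaves : ∀ a b s → 𝟙 (leaves a b ∧ s) ≤ count (outsideEnd (a , b))
    edge-leaves a b s with S a in a∈S | S b in b∈S
    ... | false | _     = ≤-trans (𝟙≤1 s) (count-lookup (outsideEnd (a , b)) (cong₂ _∧_ (cong not a∈S) (∈ᵉ-fst a b)))
    ... | true  | false = ≤-trans (𝟙≤1 s) (count-lookup (outsideEnd (a , b)) (cong₂ _∧_ (cong not b∈S) (∈ᵉ-snd a b)))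
    ... | true  | true  = z≤n
    vertex-bound : ∀ x → count (λ j → not (S x) ∧ x ∈ᵉ es j) ≤ 2 * 𝟙 (not (S x))
    vertex-bound x with S x
    ... | true  = ≤-reflexive (sum-zero {k ∸ 2} λ _ → refl)
    ... | false = two-matchings-incident≤2 M₁ M₂ x

  removed-chosen : ∀ j → toℕ j < i → removed (proj₁ (es j)) (proj₂ (es j)) ≡ true
  removed-chosen j j<i = any-allFin _ j (cong₂ _∧_ (<⇒<ᵇ-true j<i) (sameEdgeᵇ-refl (proj₁ (es j)) (proj₂ (es j))))

  module _ {H′} (H′⊆H : H′ ⊆G H) (clique : IsClique H′) where
    open _⊆G_ H′⊆H

    clique-misses-endpoint : ∀ j → IsEdge (es j) → toℕ j < i → ∃ λ x → x ∈ᵉ es j ≡ true × V H′ x ≡ false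
    clique-misses-endpoint j a≢b j<i with V H′ (proj₁ (es j)) in a∈H′ | V H′ (proj₂ (es j)) in b∈H′
    ... | false | _     = proj₁ (es j) , ∈ᵉ-fst (proj₁ (es j)) (proj₂ (es j)) , a∈H′
    ... | true  | false = proj₂ (es j) , ∈ᵉ-snd (proj₁ (es j)) (proj₂ (es j)) , b∈H′
    ... | true  | true  = contradiction (trans (sym ab∈H) ab∉H) λ ()
      where
      ab∈H : E H (proj₁ (es j)) (proj₂ (es j)) ≡ true
      ab∈H = E⊆ _ _ (clique _ _ a≢b a∈H′ b∈H′)
      ab∉H : E H (proj₁ (es j)) (proj₂ (es j)) ≡ false
      ab∉H = trans (cong (λ r → not ⌊ proj₁ (es j) ≟ proj₂ (es j) ⌋ ∧ not r) (removed-chosen j j<i)) (∧-zeroʳ _)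

    clique-misses≥1 : ∀ j → IsEdge (es j) → toℕ j < i → 1 ≤ count (not ∘ V H′)
    clique-misses≥1 j edge j<i with clique-misses-endpoint j edge j<i
    ... | _ , _ , x∉H′ = count-lookup (not ∘ V H′) (cong not x∉H′)

    clique-misses≥2 : ∀ j j′ → VertexDisjoint (es j) (es j′) → IsEdge (es j) → IsEdge (es j′)
                    → toℕ j < i → toℕ j′ < i → 2 ≤ count (not ∘ V H′)
    clique-misses≥2 j j′ disjoint edge edge′ j<i j′<i
      with clique-misses-endpoint j edge j<i | clique-misses-endpoint j′ edge′ j′<i
    ... | x , x∈es-j , x∉H′ | x′ , x′∈es-j′ , x′∉H′ =
      count-lookup₂ (not ∘ V H′) x≢x′ (cong not x∉H′) (cong not x′∉H′)
      where
      x≢x′ : x ≢ x′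
      x≢x′ refl = vertexDisjoint⇒¬shared disjoint x x∈es-j x′∈es-j′

  module Setting (k≥3 : 3 ≤ k) (i≤k∸2 : i ≤ k ∸ 2)
                 (M₁ : IsMatchingOn es lowHalf) (M₂ : IsMatchingOn es (not ∘ lowHalf)) where

    k≥2 : 2 ≤ k
    k≥2 = ≤-trans (n≤1+n 2) k≥3

    2+nonEdges-H≤k : 2 + nonEdges H ≤ k
    2+nonEdges-H≤k = begin
      2 + nonEdges H  ≤⟨ +-monoʳ-≤ 2 (≤-trans nonEdges-H≤i i≤k∸2) ⟩
      2 + (k ∸ 2)     ≡⟨ m+[n∸m]≡n k≥2 ⟩
      k               ∎
      where open ≤-Reasoning

    nonEdges-H≤2 : ¬ k ≡ 5 ⊎ ¬ i ≡ 3 → k ≡ 5 → nonEdges H ≤ 2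
    nonEdges-H≤2 (inj₁ k≢5) k≡5 = contradiction k≡5 k≢5
    nonEdges-H≤2 (inj₂ i≢3) k≡5 =
      ≤-trans nonEdges-H≤i (≤-pred (≤∧≢⇒< (subst (λ n → i ≤ n ∸ 2) k≡5 i≤k∸2) i≢3))

    2≤e-H : 2 ≤ e H
    2≤e-H = +-cancelʳ-≤ (nonEdges H) 2 (e H) (begin
      2 + nonEdges H    ≤⟨ 2+nonEdges-H≤k ⟩
      k                 ≤⟨ 3≤n⇒n≤nC2 k k≥3 ⟩
      k C 2             ≡⟨ e-H+nonEdges ⟨
      e H + nonEdges H  ∎)
      where open ≤-Reasoning

    g1-nonClique≤ : ¬ k ≡ 5 ⊎ ¬ i ≡ 3 → ∀ {H′} → H′ ⊆G H → ¬ InI H H′ → e H′ < e H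
                  → g1ratio H H′ ℚ.≤ frac (v H ∸ 2) (e H)
    g1-nonClique≤ exception {H′} H′⊆H ¬I e′<e =
      g1-ratio≤ m d t≥2 (trans v-H (sym t+m≡k)) (sym e′+d≡e) (m<n⇒0<n∸m e′<e)
        (g1-bound t m e′ d R total (subst (2 + R ≤_) (sym t+m≡k) 2+nonEdges-H≤k)
           (nonEdges-H≤2 exception ∘ trans (sym t+m≡k)) e′<tC2 e′+R≤)
      where
      open _⊆G_ H′⊆H
      t = v H′
      m = count (not ∘ V H′)
      e′ = e H′
      d = e H ∸ e′
      R = nonEdges H
      t+m≡k = v+missing≡n H′
      e′+d≡e = m+[n∸m]≡n (<⇒≤ e′<e)
      e′<tC2 = ¬InI⇒e<vC2 H′⊆H ¬I e′<e
      t≥2 = 0<nC2⇒2≤n t (≤-trans (s≤s z≤n) e′<tC2)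
      total : e′ + d + R ≡ (t + m) C 2
      total = trans (cong (_+ R) e′+d≡e) (trans e-H+nonEdges (cong (_C 2) (sym t+m≡k)))
      e′+R≤ : e′ + R ≤ t C 2 + 2 * m
      e′+R≤ = begin
        e′ + R
          ≤⟨ +-monoʳ-≤ e′ (≤-trans (nonEdges-⊆ H′⊆H) (+-monoʳ-≤ (nonEdges H′) (nonEdgesLeaving-H M₁ M₂ (V H′)))) ⟩
        e′ + (nonEdges H′ + 2 * m)  ≡⟨ +-assoc e′ (nonEdges H′) (2 * m) ⟨
        e′ + nonEdges H′ + 2 * m    ≡⟨ cong (_+ 2 * m) (e+nonEdges≡vC2 wf) ⟩
        t C 2 + 2 * m               ∎
        where open ≤-Reasoning

    g1-H : ¬ k ≡ 5 ⊎ ¬ i ≡ 3 → IsG1 H (frac (v H ∸ 2) (e H))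
    g1-H exception = (twoIsolated , isolated , two-vertices (e-twoIsolated {k}) (v-twoIsolated k≥2)) , upper
      where
      two-vertices : ∀ {H′} → e H′ ≡ 0 → v H′ ≡ 2 → g1ratio H H′ ≡ frac (v H ∸ 2) (e H)
      two-vertices e≡0 v≡2 = cong₂ frac (cong (v H ∸_) v≡2) (cong (e H ∸_) e≡0)
      isolated : G1Cand H twoIsolated
      isolated = (twoIsolated⊆ (λ _ → refl) , (λ (_ , _ , clique) → twoIsolated-¬clique k≥2 clique))
               , inj₂ (e-twoIsolated {k} , v-twoIsolated k≥2)
      upper : ∀ H′ → G1Cand H H′ → g1ratio H H′ ℚ.≤ frac (v H ∸ 2) (e H)
      upper H′ (_ , inj₂ (e≡0 , v≡2))            = ℚ.≤-reflexive (two-vertices e≡0 v≡2)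
      upper H′ ((H′⊆H , ¬I) , inj₁ (_ , e′<e)) = g1-nonClique≤ exception H′⊆H ¬I e′<e

    module _ (i≥1 : 1 ≤ i) (edges : ∀ j → IsEdge (es j)) where

      clique-2*nonEdges≤ : ∀ {H′} → H′ ⊆G H → IsClique H′ → 3 ≤ v H′
                         → 2 * nonEdges H ≤ count (not ∘ V H′) * (k ∸ 2)
      clique-2*nonEdges≤ {H′} H′⊆H clique t≥3 = bound (i ≤? 1)
        where
        m = count (not ∘ V H′)
        j₀ = fromℕ< (≤-trans i≥1 i≤k∸2)
        toℕ-j₀ = Fin.toℕ-fromℕ< (≤-trans i≥1 i≤k∸2)
        j₀<i = subst (_< i) (sym toℕ-j₀) i≥1
        m≥1 = clique-misses≥1 H′⊆H clique j₀ (edges j₀) j₀<i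
        k≥4 : 4 ≤ k
        k≥4 = subst (4 ≤_) (v+missing≡n H′) (+-mono-≤ t≥3 m≥1)
        lowHalf-<2 : ∀ j → toℕ j < 2 → lowHalf j ≡ true
        lowHalf-<2 j j<2 = <⇒<ᵇ-true (≤-trans j<2 (/-monoˡ-≤ 2 k≥4))
        m≥2 : 2 ≤ i → 2 ≤ m
        m≥2 i≥2 = clique-misses≥2 H′⊆H clique j₀ j₁ disjoint (edges j₀) (edges j₁) j₀<i j₁<i
          where
          j₁ = fromℕ< (≤-trans i≥2 i≤k∸2)
          toℕ-j₁ = Fin.toℕ-fromℕ< (≤-trans i≥2 i≤k∸2)
          j₁<i = subst (_< i) (sym toℕ-j₁) i≥2
          j₀≢j₁ : j₀ ≢ j₁
          j₀≢j₁ j₀≡j₁ = 0≢1+n (trans (sym toℕ-j₀) (trans (cong toℕ j₀≡j₁) toℕ-j₁))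
          disjoint = M₁ j₀ j₁ j₀≢j₁ (lowHalf-<2 j₀ (subst (_< 2) (sym toℕ-j₀) (s≤s z≤n)))
                                    (lowHalf-<2 j₁ (subst (_< 2) (sym toℕ-j₁) ≤-refl))
        bound : Dec (i ≤ 1) → 2 * nonEdges H ≤ m * (k ∸ 2)
        bound (yes i≤1) = ≤-trans (*-monoʳ-≤ 2 (≤-trans nonEdges-H≤i i≤1)) (*-mono-≤ m≥1 (∸-monoˡ-≤ 2 k≥4))
        bound (no  i≰1) = *-mono-≤ (m≥2 (≰⇒> i≰1)) (≤-trans nonEdges-H≤i i≤k∸2)

      g2-clique≤ : ∀ {H′} → H′ ⊆G H → 2 ≤ e H′ → IsClique H′ → frac (v H ∸ 2) (e H ∸ 1) ℚ.≤ g2ratio H′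
      g2-clique≤ {H′} H′⊆H e′≥2 clique =
        frac-≤ (v H ∸ 2) (e H ∸ 1) (t ∸ 2) (e H′ ∸ 1) (∸-monoˡ-≤ 1 2≤e-H) (∸-monoˡ-≤ 1 e′≥2)
          (subst₂ (λ a b → (a ∸ 2) * (b ∸ 1) ≤ (t ∸ 2) * (e H ∸ 1)) (trans t+m≡k (sym v-H)) (sym e′≡tC2)
            (g2-bound t m (e H ∸ 1) R (≤-trans (n≤1+n 2) t≥3) total
              (subst (λ n → 2 * R ≤ m * (n ∸ 2)) (sym t+m≡k) (clique-2*nonEdges≤ H′⊆H clique t≥3))))
        where
        open _⊆G_ H′⊆H
        t = v H′
        m = count (not ∘ V H′)
        R = nonEdges H
        t+m≡k = v+missing≡n H′
        e′≡tC2 = isClique⇒e≡vC2 wf clique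
        t≥3 = 2≤nC2⇒3≤n t (subst (2 ≤_) e′≡tC2 e′≥2)
        total : suc (e H ∸ 1) + R ≡ (t + m) C 2
        total = trans (cong (_+ R) (m+[n∸m]≡n (≤-trans (n≤1+n 1) 2≤e-H)))
                      (trans e-H+nonEdges (cong (_C 2) (sym t+m≡k)))

      g2-H : IsG2 H (frac (v H ∸ 2) (e H ∸ 1))
      g2-H = (H , (⊆G-refl H-wellFormed , 2≤e-H , inj₂ ((λ _ → refl) , (λ _ _ → refl))) , refl) , lower
        where
        lower : ∀ H′ → G2Cand H H′ → frac (v H ∸ 2) (e H ∸ 1) ℚ.≤ g2ratio H′
        lower H′ (_ , _ , inj₂ same) = ℚ.≤-reflexive
          (cong₂ frac (cong (_∸ 2) (sym (sameGraph⇒v≡ same))) (cong (_∸ 1) (sym (sameGraph⇒e≡ same))))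
        lower H′ (H′⊆H , e′≥2 , inj₁ (_ , _ , clique)) = g2-clique≤ H′⊆H e′≥2 clique

lemma6p1 : (k : ℕ) → 3 ≤ k
    → (es : Fin (k ∸ 2) → Edge k)
    → (∀ j → IsEdge (es j))
    → (∀ j j' → j ≢ j' → ¬ SameEdge (es j) (es j'))
    → (∀ j j' → j ≢ j' → toℕ j < k / 2 → toℕ j' < k / 2 → VertexDisjoint (es j) (es j'))
    → (∀ j j' → j ≢ j' → ¬ (toℕ j < k / 2) → ¬ (toℕ j' < k / 2) → VertexDisjoint (es j) (es j'))
    → (i : ℕ) → 1 ≤ i → i ≤ k ∸ 2
    → ((¬ (k ≡ 5) ⊎ ¬ (i ≡ 3)) → IsG1 (Hgraph k es i) (frac (v (Hgraph k es i) ∸ 2) (e (Hgraph k es i))))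
      × IsG2 (Hgraph k es i) (frac (v (Hgraph k es i) ∸ 2) (e (Hgraph k es i) ∸ 1))
lemma6p1 k k≥3 es edges _ M₁ M₂ i i≥1 i≤k∸2 = g1-H , g2-H i≥1 edges
  where
  open Deletion k es i
  open Setting k≥3 i≤k∸2 (λ j j′ j≢j′ p q → M₁ j j′ j≢j′ (<ᵇ-true⇒< p) (<ᵇ-true⇒< q))
                         (λ j j′ j≢j′ p q → M₂ j j′ j≢j′ (not-<ᵇ-true⇒≮ p) (not-<ᵇ-true⇒≮ q))
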